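{- Let $1\le t\le k\le n$, $A\in\binom{[n]}{k}$ and $T\in\binom{[n]}{t}$ with $T\not\subseteq A$. Then the number of sets $F\in\binom{[n]}{k}$ with $T\subseteq F$ and $|F\cap A|\ge t$ is at most $\binom{k+t}{t+1}\binom{n-t-1}{k-t-1}$. -}

module Defs where

open import Data.Nat using (ℕ; zero; suc; _≤_; _≤?_; _≟_)
open import Data.Fin.Subset using (Subset; _⊆_; _∩_; ∣_∣; inside; outside)
open import Data.Fin.Subset.Properties using (_⊆?_)
open import Data.List using (List; []; _∷_; _++_; map; filter; length)
open import Data.Vec using (_∷_; [])
open import Data.Product using (_×_)
open import Relation.Binary.PropositionalEquality using (_≡_)
open import Relation.Nullary.Decidable using (Dec; _×-dec_)

allSubsets : (n : ℕ) → List (Subset n)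
allSubsets zero    = [] ∷ []
allSubsets (suc n) = map (outside ∷_) (allSubsets n) ++ map (inside ∷_) (allSubsets n)

Good : {n : ℕ} (k t : ℕ) (A T F : Subset n) → Set
Good k t A T F = (∣ F ∣ ≡ k) × (T ⊆ F) × (t ≤ ∣ F ∩ A ∣)

good? : {n : ℕ} (k t : ℕ) (A T F : Subset n) → Dec (Good k t A T F)
good? k t A T F = (∣ F ∣ ≟ k) ×-dec (T ⊆? F) ×-dec (t ≤? ∣ F ∩ A ∣)

countGood : (n k t : ℕ) (A T : Subset n) → ℕ
countGood n k t A T = length (filter (good? k t A T) (allSubsets n))

-- Binomial coefficient with possibly negative indices, written as
-- binomOff a b d = C(a − d, b − d), with the convention C(x, y) = 0 when
-- y < 0 (i.e. b < d) and the usual value otherwise (here a ≥ b is implied in use).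
-- Used for C(n−t−1, k−t−1), which is 0 when k = t.
open import Data.Nat using (_<_; _<?_; _∸_)
open import Data.Nat.Combinatorics using (_C_)
open import Relation.Nullary.Decidable using (yes; no)

binomSub : (a b d : ℕ) → ℕ
binomSub a b d with d <? suc b
... | yes _ = (a ∸ d) C (b ∸ d)
... | no  _ = 0

-- Put B = T ∪ A, so |B| ≤ k + t. A set F ⊇ T with |F ∩ A| ≥ t also contains a point of
-- T ∖ A, hence |F ∩ B| ≥ t + 1. The k-sets F with |F ∩ B| ≥ m number at most
-- C(|B|, m) · C(n − m, k − m) (pick m points of F ∩ B, then the other k − m points of F);
-- this is proved by induction on n, splitting on whether the first point lies in F and in B
-- and closing each case with Pascal's rule in one of the two binomial factors.
module Submission where

open import Defs
open import Data.Nat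
  using (ℕ; zero; suc; pred; _≤_; _<_; _≤′_; ≤′-refl; ≤′-step; _+_; _*_; _∸_; _≤?_; _<?_; z≤n; s≤s; s≤s⁻¹)
open import Data.Nat.Properties
open import Data.Nat.Combinatorics using (_C_; nCk+nC[k+1]≡[n+1]C[k+1])
open import Data.Fin.Properties using (¬∀⟶∃¬)
open import Data.Fin.Subset using (Subset; _⊆_; _⊈_; _⊂_; _∈_; _∉_; _∩_; _∪_; ∣_∣; inside; outside)
open import Data.Fin.Subset.Properties
  using (_∈?_; x∈p∩q⁺; x∈p∩q⁻; p⊆p∪q; q⊆p∪q; p⊂q⇒∣p∣<∣q∣; ∣p∣≤n; ∣p∣≤∣x∷p∣)
open import Data.Vec using (_∷_; [])
open import Data.List using ([]; _∷_; _++_; map; filter; length)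
open import Data.List.Properties using (filter-++; length-++; filter-none)
open import Data.List.Relation.Unary.All using (universal)
open import Data.List.Relation.Binary.Sublist.Propositional using (⊆-refl)
open import Data.List.Relation.Binary.Sublist.Heterogeneous.Properties using (length-mono-≤; ⊆-filter-Sublist)
open import Data.Product using (_×_; _,_; ∃; proj₂)
open import Function using (_∘_; const)
open import Relation.Nullary using (¬_; yes; no; contradiction)
open import Relation.Nullary.Decidable using (_×-dec_; _→-dec_; decidable-stable)
open import Relation.Unary using (Pred; Decidable) renaming (_⊆_ to _⇒_)
open import Relation.Binary.PropositionalEquality
  using (_≡_; refl; sym; trans; cong; cong₂; subst; subst₂; module ≡-Reasoning)

module _ {a p q} {A : Set a} {P : Pred A p} {Q : Pred A q} (P? : Decidable P) (Q? : Decidable Q) where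

  length-filter-mono : P ⇒ Q → ∀ xs → length (filter P? xs) ≤ length (filter Q? xs)
  length-filter-mono P⇒Q xs = length-mono-≤ (⊆-filter-Sublist P? Q? (λ { refl → P⇒Q }) (⊆-refl {x = xs}))

module _ {a p} {A : Set a} {P : Pred A p} (P? : Decidable P) where

  length-filter-none : (∀ x → ¬ P x) → ∀ xs → length (filter P? xs) ≡ 0
  length-filter-none ¬P xs = cong length (filter-none P? (universal ¬P xs))

  length-filter-map : ∀ {b} {B : Set b} (f : B → A) xs →
    length (filter P? (map f xs)) ≡ length (filter (P? ∘ f) xs)
  length-filter-map f [] = refl
  length-filter-map f (x ∷ xs) with P? (f x)
  ... | yes _ = cong suc (length-filter-map f xs)
  ... | no _  = length-filter-map f xs

length-filter-allSubsets-suc : ∀ {p n} {P : Pred (Subset (suc n)) p} (P? : Decidable P) →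
  length (filter P? (allSubsets (suc n))) ≡
  length (filter (P? ∘ (outside ∷_)) (allSubsets n)) + length (filter (P? ∘ (inside ∷_)) (allSubsets n))
length-filter-allSubsets-suc {n = n} P? = begin
  length (filter P? (map (outside ∷_) L ++ map (inside ∷_) L))
    ≡⟨ cong length (filter-++ P? (map (outside ∷_) L) (map (inside ∷_) L)) ⟩
  length (filter P? (map (outside ∷_) L) ++ filter P? (map (inside ∷_) L))
    ≡⟨ length-++ (filter P? (map (outside ∷_) L)) ⟩
  length (filter P? (map (outside ∷_) L)) + length (filter P? (map (inside ∷_) L))
    ≡⟨ cong₂ _+_ (length-filter-map P? (outside ∷_) L) (length-filter-map P? (inside ∷_) L) ⟩
  length (filter (P? ∘ (outside ∷_)) L) + length (filter (P? ∘ (inside ∷_)) L) ∎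
  where
  open ≡-Reasoning
  L = allSubsets n

nCk≤[1+n]Ck : ∀ n k → n C k ≤ suc n C k
nCk≤[1+n]Ck n zero    = ≤-refl
nCk≤[1+n]Ck n (suc k) = subst (n C suc k ≤_) (nCk+nC[k+1]≡[n+1]C[k+1] n k) (m≤n+m (n C suc k) (n C k))

C-monoˡ-≤ : ∀ {m n} k → m ≤ n → m C k ≤ n C k
C-monoˡ-≤ k m≤n = go (≤⇒≤′ m≤n)
  where
  go : ∀ {m n} → m ≤′ n → m C k ≤ n C k
  go ≤′-refl              = ≤-refl
  go {n = suc n} (≤′-step m≤′n) = ≤-trans (go m≤′n) (nCk≤[1+n]Ck n k)

binomSub-≤ : ∀ n {k m} → m ≤ k → binomSub n k m ≡ (n ∸ m) C (k ∸ m)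
binomSub-≤ n {k} {m} m≤k with m <? suc k
... | yes _   = refl
... | no m≮1+k = contradiction (s≤s m≤k) m≮1+k

binomSub-> : ∀ n {k m} → k < m → binomSub n k m ≡ 0
binomSub-> n {k} {m} k<m with m <? suc k
... | yes m<1+k = contradiction k<m (≤⇒≯ (s≤s⁻¹ m<1+k))
... | no _      = refl

binomSub-suc : ∀ n k m → binomSub (suc n) (suc k) (suc m) ≡ binomSub n k m
binomSub-suc n k m with m ≤? k
... | yes m≤k = trans (binomSub-≤ (suc n) (s≤s m≤k)) (sym (binomSub-≤ n m≤k))
... | no m≰k  = trans (binomSub-> (suc n) (s≤s (≰⇒> m≰k))) (sym (binomSub-> n (≰⇒> m≰k)))

binomSub-indepˡ : ∀ a b {k m} → k ≤ m → binomSub a k m ≡ binomSub b k m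
binomSub-indepˡ a b {k} {m} k≤m with m ≤? k
... | yes m≤k = begin
  binomSub a k m     ≡⟨ binomSub-≤ a m≤k ⟩
  (a ∸ m) C (k ∸ m)  ≡⟨ cong ((a ∸ m) C_) k∸m≡0 ⟩
  1                  ≡⟨ cong ((b ∸ m) C_) k∸m≡0 ⟨
  (b ∸ m) C (k ∸ m)  ≡⟨ binomSub-≤ b m≤k ⟨
  binomSub b k m     ∎
  where
  open ≡-Reasoning
  k∸m≡0 : k ∸ m ≡ 0
  k∸m≡0 = m≤n⇒m∸n≡0 k≤m
... | no m≰k = trans (binomSub-> a (≰⇒> m≰k)) (sym (binomSub-> b (≰⇒> m≰k)))

binomSub-monoˡ-≤ : ∀ n k m → binomSub n k m ≤ binomSub (suc n) k m
binomSub-monoˡ-≤ n k m with m ≤? k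
... | yes m≤k = subst₂ _≤_ (sym (binomSub-≤ n m≤k)) (sym (binomSub-≤ (suc n) m≤k))
                  (C-monoˡ-≤ (k ∸ m) (∸-monoˡ-≤ m (n≤1+n n)))
... | no m≰k  = subst (_≤ binomSub (suc n) k m) (sym (binomSub-> n (≰⇒> m≰k))) z≤n

binomSub-pascal : ∀ {n} k {m} → m ≤ n → binomSub n (suc k) m + binomSub n k m ≡ binomSub (suc n) (suc k) m
binomSub-pascal {n} k {m} m≤n with m ≤? k
... | yes m≤k = begin
  binomSub n (suc k) m + binomSub n k m
    ≡⟨ cong₂ _+_ (binomSub-≤ n (m≤n⇒m≤1+n m≤k)) (binomSub-≤ n m≤k) ⟩
  (n ∸ m) C (suc k ∸ m) + (n ∸ m) C (k ∸ m)
    ≡⟨ cong (λ j → (n ∸ m) C j + (n ∸ m) C (k ∸ m)) (+-∸-assoc 1 m≤k) ⟩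
  (n ∸ m) C suc (k ∸ m) + (n ∸ m) C (k ∸ m)
    ≡⟨ +-comm ((n ∸ m) C suc (k ∸ m)) _ ⟩
  (n ∸ m) C (k ∸ m) + (n ∸ m) C suc (k ∸ m)
    ≡⟨ nCk+nC[k+1]≡[n+1]C[k+1] (n ∸ m) (k ∸ m) ⟩
  suc (n ∸ m) C suc (k ∸ m)
    ≡⟨ cong₂ _C_ (+-∸-assoc 1 m≤n) (+-∸-assoc 1 m≤k) ⟨
  (suc n ∸ m) C (suc k ∸ m)
    ≡⟨ binomSub-≤ (suc n) (m≤n⇒m≤1+n m≤k) ⟨
  binomSub (suc n) (suc k) m ∎
  where open ≡-Reasoning
... | no m≰k = begin
  binomSub n (suc k) m + binomSub n k m  ≡⟨ cong (binomSub n (suc k) m +_) (binomSub-> n (≰⇒> m≰k)) ⟩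
  binomSub n (suc k) m + 0               ≡⟨ +-identityʳ _ ⟩
  binomSub n (suc k) m                   ≡⟨ binomSub-indepˡ n (suc n) (≰⇒> m≰k) ⟩
  binomSub (suc n) (suc k) m             ∎
  where open ≡-Reasoning

Meets : ∀ {n} (B : Subset n) (k m : ℕ) → Pred (Subset n) _
Meets B k m F = ∣ F ∣ ≡ k × m ≤ ∣ F ∩ B ∣

meets? : ∀ {n} (B : Subset n) k m → Decidable (Meets B k m)
meets? B k m F = (∣ F ∣ ≟ k) ×-dec (m ≤? ∣ F ∩ B ∣)

countMeets : (n : ℕ) (B : Subset n) (k m : ℕ) → ℕ
countMeets n B k m = length (filter (meets? B k m) (allSubsets n))

countMeets∋0 : ∀ {n} (B : Subset (suc n)) (k m : ℕ) → ℕ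
countMeets∋0 {n} B k m = length (filter (meets? B k m ∘ (inside ∷_)) (allSubsets n))

countMeets-suc : ∀ n b (B : Subset n) k m →
  countMeets (suc n) (b ∷ B) k m ≡ countMeets n B k m + countMeets∋0 (b ∷ B) k m
countMeets-suc n b B k m = length-filter-allSubsets-suc (meets? (b ∷ B) k m)

countMeets-> : ∀ n (B : Subset n) k {m} → n < m → countMeets n B k m ≡ 0
countMeets-> n B k n<m =
  length-filter-none (meets? B k _)
    (λ F (_ , m≤∣F∩B∣) → <⇒≱ n<m (≤-trans m≤∣F∩B∣ (∣p∣≤n (F ∩ B)))) (allSubsets n)

countMeets∋0-zero : ∀ {n} (B : Subset (suc n)) m → countMeets∋0 B 0 m ≡ 0
countMeets∋0-zero {n} B m = length-filter-none (meets? B 0 m ∘ (inside ∷_)) (λ { F (() , _) }) (allSubsets n)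

countMeets∋0-outside : ∀ {n} (B : Subset n) k m → countMeets∋0 (outside ∷ B) (suc k) m ≤ countMeets n B k m
countMeets∋0-outside {n} B k m = length-filter-mono (meets? (outside ∷ B) (suc k) m ∘ (inside ∷_)) (meets? B k m)
  (λ (∣F∣+1≡k+1 , m≤∣F∩B∣) → suc-injective ∣F∣+1≡k+1 , m≤∣F∩B∣) (allSubsets n)

countMeets∋0-inside : ∀ {n} (B : Subset n) k m → countMeets∋0 (inside ∷ B) (suc k) m ≤ countMeets n B k (pred m)
countMeets∋0-inside {n} B k m = length-filter-mono (meets? (inside ∷ B) (suc k) m ∘ (inside ∷_)) (meets? B k (pred m))
  (λ (∣F∣+1≡k+1 , m≤∣F∩B∣+1) → suc-injective ∣F∣+1≡k+1 , pred-mono-≤ m≤∣F∩B∣+1) (allSubsets n)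

module CountMeetsStep {n} (B : Subset n) (ih : ∀ k m → countMeets n B k m ≤ (∣ B ∣ C m) * binomSub n k m) where

  open ≤-Reasoning

  β : ℕ
  β = ∣ B ∣

  pascal-step : ∀ k m {y} → y ≤ countMeets n B k m →
    countMeets n B (suc k) m + y ≤ (β C m) * binomSub (suc n) (suc k) m
  pascal-step k m {y} y≤ with m ≤? n
  ... | yes m≤n = begin
    countMeets n B (suc k) m + y
      ≤⟨ +-mono-≤ (ih (suc k) m) (≤-trans y≤ (ih k m)) ⟩
    (β C m) * binomSub n (suc k) m + (β C m) * binomSub n k m
      ≡⟨ *-distribˡ-+ (β C m) _ _ ⟨
    (β C m) * (binomSub n (suc k) m + binomSub n k m)
      ≡⟨ cong ((β C m) *_) (binomSub-pascal k m≤n) ⟩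
    (β C m) * binomSub (suc n) (suc k) m ∎
  ... | no m≰n = begin
    countMeets n B (suc k) m + y                   ≤⟨ +-monoʳ-≤ _ y≤ ⟩
    countMeets n B (suc k) m + countMeets n B k m
      ≡⟨ cong₂ _+_ (countMeets-> n B (suc k) (≰⇒> m≰n)) (countMeets-> n B k (≰⇒> m≰n)) ⟩
    0                                              ≤⟨ z≤n ⟩
    (β C m) * binomSub (suc n) (suc k) m           ∎

  shift-step : ∀ k m {y} → y ≤ countMeets n B k m →
    countMeets n B (suc k) (suc m) + y ≤ (suc β C suc m) * binomSub (suc n) (suc k) (suc m)
  shift-step k m {y} y≤ = begin
    countMeets n B (suc k) (suc m) + y
      ≤⟨ +-mono-≤ (ih (suc k) (suc m)) (≤-trans y≤ (ih k m)) ⟩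
    (β C suc m) * binomSub n (suc k) (suc m) + (β C m) * binomSub n k m
      ≤⟨ +-mono-≤ (*-monoʳ-≤ (β C suc m) (binomSub-monoˡ-≤ n (suc k) (suc m)))
                  (≤-reflexive (cong ((β C m) *_) (sym (binomSub-suc n k m)))) ⟩
    (β C suc m) * Z + (β C m) * Z
      ≡⟨ +-comm ((β C suc m) * Z) _ ⟩
    (β C m) * Z + (β C suc m) * Z
      ≡⟨ *-distribʳ-+ Z (β C m) (β C suc m) ⟨
    (β C m + β C suc m) * Z
      ≡⟨ cong (_* Z) (nCk+nC[k+1]≡[n+1]C[k+1] β m) ⟩
    (suc β C suc m) * Z ∎
    where
    Z = binomSub (suc n) (suc k) (suc m)

  empty-step : ∀ b m → countMeets n B 0 m + countMeets∋0 (b ∷ B) 0 m ≤ (∣ b ∷ B ∣ C m) * binomSub (suc n) 0 m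
  empty-step b m = begin
    countMeets n B 0 m + countMeets∋0 (b ∷ B) 0 m  ≡⟨ cong (countMeets n B 0 m +_) (countMeets∋0-zero (b ∷ B) m) ⟩
    countMeets n B 0 m + 0                         ≡⟨ +-identityʳ _ ⟩
    countMeets n B 0 m                             ≤⟨ ih 0 m ⟩
    (β C m) * binomSub n 0 m
      ≤⟨ *-mono-≤ (C-monoˡ-≤ m (∣p∣≤∣x∷p∣ b B)) (binomSub-monoˡ-≤ n 0 m) ⟩
    (∣ b ∷ B ∣ C m) * binomSub (suc n) 0 m         ∎

  countMeets-suc-≤ : ∀ b k m → countMeets (suc n) (b ∷ B) k m ≤ (∣ b ∷ B ∣ C m) * binomSub (suc n) k m
  countMeets-suc-≤ b k m = ≤-trans (≤-reflexive (countMeets-suc n b B k m)) (split b k m)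
    where
    split : ∀ b k m → countMeets n B k m + countMeets∋0 (b ∷ B) k m ≤ (∣ b ∷ B ∣ C m) * binomSub (suc n) k m
    split b       zero    m       = empty-step b m
    split outside (suc k) m       = pascal-step k m (countMeets∋0-outside B k m)
    split inside  (suc k) zero    = pascal-step k 0 (countMeets∋0-inside B k 0)
    split inside  (suc k) (suc m) = shift-step k m (countMeets∋0-inside B k (suc m))

countMeets-≤ : ∀ n (B : Subset n) k m → countMeets n B k m ≤ (∣ B ∣ C m) * binomSub n k m
countMeets-≤ zero    []      zero    zero    = ≤-refl
countMeets-≤ zero    []      zero    (suc m) = z≤n
countMeets-≤ zero    []      (suc k) m       = z≤n
countMeets-≤ (suc n) (b ∷ B) k       m       = CountMeetsStep.countMeets-suc-≤ B (countMeets-≤ n B) b k m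

⊈-witness : ∀ {n} {T A : Subset n} → T ⊈ A → ∃ λ x → x ∈ T × x ∉ A
⊈-witness {n} {T} {A} T⊈A
  with x , x∈T⇏x∈A ← ¬∀⟶∃¬ n (λ x → x ∈ T → x ∈ A) (λ x → x ∈? T →-dec x ∈? A) (λ T⊆A → T⊈A (T⊆A _))
  = x , decidable-stable (x ∈? T) (λ x∉T → x∈T⇏x∈A (λ x∈T → contradiction x∈T x∉T))
      , x∈T⇏x∈A ∘ const

p∩r⊂p∩[q∪r] : ∀ {n} {p q r : Subset n} → q ⊆ p → q ⊈ r → p ∩ r ⊂ p ∩ (q ∪ r)
p∩r⊂p∩[q∪r] {p = p} {q} {r} q⊆p q⊈r with x , x∈q , x∉r ← ⊈-witness q⊈r =
  p∩r⊆p∩[q∪r] , x , x∈p∩q⁺ (q⊆p x∈q , p⊆p∪q r x∈q) , x∉r ∘ proj₂ ∘ x∈p∩q⁻ p r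
  where
  p∩r⊆p∩[q∪r] : p ∩ r ⊆ p ∩ (q ∪ r)
  p∩r⊆p∩[q∪r] y∈p∩r with y∈p , y∈r ← x∈p∩q⁻ p r y∈p∩r = x∈p∩q⁺ (y∈p , q⊆p∪q q r y∈r)

∣p∪q∣≤∣p∣+∣q∣ : ∀ {n} (p q : Subset n) → ∣ p ∪ q ∣ ≤ ∣ p ∣ + ∣ q ∣
∣p∪q∣≤∣p∣+∣q∣ []            []            = z≤n
∣p∪q∣≤∣p∣+∣q∣ (outside ∷ p) (outside ∷ q) = ∣p∪q∣≤∣p∣+∣q∣ p q
∣p∪q∣≤∣p∣+∣q∣ (outside ∷ p) (inside ∷ q)  =
  ≤-trans (s≤s (∣p∪q∣≤∣p∣+∣q∣ p q)) (≤-reflexive (sym (+-suc ∣ p ∣ ∣ q ∣)))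
∣p∪q∣≤∣p∣+∣q∣ (inside ∷ p)  (b ∷ q)       =
  s≤s (≤-trans (∣p∪q∣≤∣p∣+∣q∣ p q) (+-monoʳ-≤ ∣ p ∣ (∣p∣≤∣x∷p∣ b q)))

-- The bound holds without the size hypotheses 1 ≤ t ≤ k ≤ n.
lemma2p3 : (n k t : ℕ) → 1 ≤ t → t ≤ k → k ≤ n →
    (A T : Subset n) → ∣ A ∣ ≡ k → ∣ T ∣ ≡ t → ¬ (T ⊆ A) →
    countGood n k t A T ≤ ((k + t) C (suc t)) * binomSub n k (suc t)
lemma2p3 n k t _ _ _ A T ∣A∣≡k ∣T∣≡t T⊈A = begin
  countGood n k t A T
    ≤⟨ length-filter-mono (good? k t A T) (meets? (T ∪ A) k (suc t)) good⇒meets (allSubsets n) ⟩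
  countMeets n (T ∪ A) k (suc t)
    ≤⟨ countMeets-≤ n (T ∪ A) k (suc t) ⟩
  (∣ T ∪ A ∣ C suc t) * binomSub n k (suc t)
    ≤⟨ *-monoˡ-≤ (binomSub n k (suc t)) (C-monoˡ-≤ (suc t) ∣T∪A∣≤k+t) ⟩
  ((k + t) C suc t) * binomSub n k (suc t) ∎
  where
  open ≤-Reasoning

  good⇒meets : Good k t A T ⇒ Meets (T ∪ A) k (suc t)
  good⇒meets (∣F∣≡k , T⊆F , t≤∣F∩A∣) =
    ∣F∣≡k , ≤-trans (s≤s t≤∣F∩A∣) (p⊂q⇒∣p∣<∣q∣ (p∩r⊂p∩[q∪r] T⊆F T⊈A))

  ∣T∪A∣≤k+t : ∣ T ∪ A ∣ ≤ k + t
  ∣T∪A∣≤k+t =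
    ≤-trans (∣p∪q∣≤∣p∣+∣q∣ T A) (≤-reflexive (trans (cong₂ _+_ ∣T∣≡t ∣A∣≡k) (+-comm t k)))
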